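{- Let $(E,\varphi)$ be a uniquely generated violator space, and let $ex:2^E\to 2^E$ be its extreme point operator. Then for all $X,Y,Z\subseteq E$: (X1) $ex(ex(X))=ex(X)$; (X2) if $ex(X)=ex(Y)$ then $ex(X\cup Y)=ex(X)=ex(Y)$; (X3) if $X\subseteq Y\subseteq Z$ and $ex(X)=ex(Z)$ then $ex(X)=ex(Y)=ex(Z)$; (X4) if $ex(X)=ex(Y)$ then $ex(X\cap Y)=ex(X)=ex(Y)$.
   Context: A violator space is a pair $(E,\varphi)$ with $E$ finite and $\varphi:2^E\to 2^E$ such that for all $X,Y\subseteq E$: (V1) $X\subseteq\varphi(X)$, and (V2) if $X\subseteq Y\subseteq\varphi(X)$ then $\varphi(X)=\varphi(Y)$. For $X\subseteq E$, a basis of $X$ is an inclusion-minimal set $B\subseteq E$ (not necessarily contained in $X$) with $\varphi(B)=\varphi(X)$; the space is uniquely generated if every $X\subseteq E$ has exactly one basis. The extreme point operator is $ex(X)=\{x\in X: x\notin\varphi(X\setminus\{x\})\}$. -}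

module Defs where

open import Data.Nat using (ℕ)
open import Data.Bool using (Bool; _∧_; not)
open import Data.Fin using (Fin)
open import Data.Fin.Subset using (Subset; _⊆_; _⊂_; _-_)
open import Data.Vec using (tabulate; lookup)
open import Data.Product using (_×_; Σ)
open import Relation.Binary.PropositionalEquality using (_≡_; _≢_)

record IsViolatorSpace {n : ℕ} (φ : Subset n → Subset n) : Set where
  field
    V1 : ∀ X → X ⊆ φ X
    V2 : ∀ X Y → X ⊆ Y → Y ⊆ φ X → φ X ≡ φ Y

IsBasis : {n : ℕ} → (Subset n → Subset n) → Subset n → Subset n → Set
IsBasis φ X B = (φ B ≡ φ X) × (∀ B′ → B′ ⊂ B → φ B′ ≢ φ X)

UniquelyGenerated : {n : ℕ} → (Subset n → Subset n) → Set
UniquelyGenerated φ =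
  ∀ X → Σ (Subset _) (λ B → IsBasis φ X B × (∀ B′ → IsBasis φ X B′ → B′ ≡ B))

ex : {n : ℕ} → (Subset n → Subset n) → Subset n → Subset n
ex φ X = tabulate (λ x → lookup X x ∧ not (lookup (φ (X - x)) x))

-- In a uniquely generated violator space the unique basis B of X lies inside X:
-- deleting redundant points of X (those x with φ (X - x) = φ X) one at a time
-- ends in a set that is a basis of itself and has the closure of X.  A point of
-- X missing from B is redundant, since B ⊆ X - x ⊆ X; a redundant point is missing
-- from B, since B is then also the basis of X - x.  As x ∈ X is redundant iff
-- x ∈ φ (X - x), this makes ex X = B.  So ex X = ex Y iff φ X = φ Y, and ex X has
-- the closure of X; each of (X1)–(X4) is then an instance of axiom V2.
module Submission where

open import Defs
open import Data.Nat using (ℕ; _<_)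
open import Data.Nat.Induction using (<-wellFounded)
open import Data.Bool using (true; false; _∧_; not) renaming (_≟_ to _≟ᵇ_)
open import Data.Fin using (Fin) renaming (_≟_ to _≟ᶠ_)
open import Data.Fin.Properties using (any?)
open import Data.Fin.Subset using (Subset; _⊆_; _∪_; _∩_; _∈_; _∉_; _-_; _─_; ⁅_⁆; ∣_∣)
open import Data.Fin.Subset.Properties
  using (_∈?_; x∈⁅x⁆; ⊆-refl; ⊆-trans; ⊆-antisym; p─q⊆p; x∈p∧x≢y⇒x∈p-y;
         x∈p⇒∣p-x∣<∣p∣; p⊆p∪q; x∈p∪q⁻; x∈p∩q⁺; p∩q⊆p)
open import Data.Vec using (_∷_; there; lookup)
open import Data.Vec.Properties using (≡-dec; lookup∘tabulate; []=⇒lookup; lookup⇒[]=)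
open import Data.Product using (Σ; _×_; _,_; proj₁; proj₂)
open import Data.Sum using (inj₁; inj₂)
open import Data.Empty using (⊥-elim)
open import Function using (_∘_)
open import Induction.WellFounded using (Acc; acc)
open import Relation.Nullary using (Dec; yes; no; ¬_; _×-dec_)
open import Relation.Binary.PropositionalEquality using (_≡_; _≢_; refl; sym; trans; cong; subst)

x∈p─q⇒x∉q : ∀ {n} {p q : Subset n} {x : Fin n} → x ∈ p ─ q → x ∉ q
x∈p─q⇒x∉q {p = _ ∷ _} {q = true  ∷ _} (there x∈) (there x∈q) = x∈p─q⇒x∉q x∈ x∈q
x∈p─q⇒x∉q {p = _ ∷ _} {q = false ∷ _} (there x∈) (there x∈q) = x∈p─q⇒x∉q x∈ x∈q

x∉p-x : ∀ {n} {p : Subset n} {x : Fin n} → x ∉ p - x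
x∉p-x {x = x} x∈p-x = x∈p─q⇒x∉q x∈p-x (x∈⁅x⁆ x)

p⊆q∧x∉p⇒p⊆q-x : ∀ {n} {p q : Subset n} {x : Fin n} → p ⊆ q → x ∉ p → p ⊆ q - x
p⊆q∧x∉p⇒p⊆q-x p⊆q x∉p y∈p = x∈p∧x≢y⇒x∈p-y (p⊆q y∈p) λ { refl → x∉p y∈p }

∧-not≡true⁻ : ∀ b c → b ∧ not c ≡ true → b ≡ true × c ≢ true
∧-not≡true⁻ true false refl = refl , λ ()

∧-not≡true⁺ : ∀ {b c} → b ≡ true → c ≢ true → b ∧ not c ≡ true
∧-not≡true⁺ {c = false} refl _ = refl
∧-not≡true⁺ {c = true}  refl c≢true = ⊥-elim (c≢true refl)

module _ {n : ℕ} (φ : Subset n → Subset n) {X : Subset n} {x : Fin n} where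

  private
    lookup-ex : lookup (ex φ X) x ≡ lookup X x ∧ not (lookup (φ (X - x)) x)
    lookup-ex = lookup∘tabulate (λ y → lookup X y ∧ not (lookup (φ (X - y)) y)) x

  ∈-ex⁻ : x ∈ ex φ X → x ∈ X × x ∉ φ (X - x)
  ∈-ex⁻ x∈ex with ∧-not≡true⁻ _ _ (trans (sym lookup-ex) ([]=⇒lookup x∈ex))
  ... | X[x] , φ[x]≢true = lookup⇒[]= x X X[x] , φ[x]≢true ∘ []=⇒lookup

  ∈-ex⁺ : x ∈ X → x ∉ φ (X - x) → x ∈ ex φ X
  ∈-ex⁺ x∈X x∉φ = lookup⇒[]= x (ex φ X)
    (trans lookup-ex (∧-not≡true⁺ ([]=⇒lookup x∈X) (x∉φ ∘ lookup⇒[]= x _)))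

ex-⊆ : ∀ {n} (φ : Subset n → Subset n) (X : Subset n) → ex φ X ⊆ X
ex-⊆ φ X = proj₁ ∘ ∈-ex⁻ φ

module ViolatorSpace {n : ℕ} {φ : Subset n → Subset n} (V : IsViolatorSpace φ) where
  open IsViolatorSpace V

  φ-≡⇒⊆φ : ∀ {A B} → φ A ≡ φ B → B ⊆ φ A
  φ-≡⇒⊆φ φA≡φB = subst (_ ∈_) (sym φA≡φB) ∘ V1 _

  φ-sandwich : ∀ {X Y Z} → X ⊆ Y → Y ⊆ Z → φ X ≡ φ Z → φ X ≡ φ Y
  φ-sandwich X⊆Y Y⊆Z φX≡φZ = V2 _ _ X⊆Y (⊆-trans Y⊆Z (φ-≡⇒⊆φ φX≡φZ))

  φ-∪ : ∀ {X Y} → φ X ≡ φ Y → φ X ≡ φ (X ∪ Y)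
  φ-∪ {X} {Y} φX≡φY = V2 X (X ∪ Y) (p⊆p∪q Y) X∪Y⊆φX
    where
    X∪Y⊆φX : X ∪ Y ⊆ φ X
    X∪Y⊆φX z∈X∪Y with x∈p∪q⁻ X Y z∈X∪Y
    ... | inj₁ z∈X = V1 X z∈X
    ... | inj₂ z∈Y = φ-≡⇒⊆φ φX≡φY z∈Y

  Redundant : Subset n → Fin n → Set
  Redundant X x = φ (X - x) ≡ φ X

  LocallyMinimal : Subset n → Set
  LocallyMinimal X = ∀ {x} → x ∈ X → ¬ Redundant X x

  ∈φ⇒redundant : ∀ {X x} → x ∈ φ (X - x) → Redundant X x
  ∈φ⇒redundant {X} {x} x∈φ = V2 (X - x) X (p─q⊆p X ⁅ x ⁆) X⊆φ
    where
    X⊆φ : X ⊆ φ (X - x)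
    X⊆φ {y} y∈X with y ≟ᶠ x
    ... | yes refl = x∈φ
    ... | no y≢x = V1 _ (x∈p∧x≢y⇒x∈p-y y∈X y≢x)

  redundant⇒∈φ : ∀ {X x} → x ∈ X → Redundant X x → x ∈ φ (X - x)
  redundant⇒∈φ x∈X redundant = φ-≡⇒⊆φ redundant x∈X

  ∈-ex⇒irredundant : ∀ {X x} → x ∈ ex φ X → x ∈ X × ¬ Redundant X x
  ∈-ex⇒irredundant x∈ex with ∈-ex⁻ φ x∈ex
  ... | x∈X , x∉φ = x∈X , x∉φ ∘ redundant⇒∈φ x∈X

  irredundant⇒∈-ex : ∀ {X x} → x ∈ X → ¬ Redundant X x → x ∈ ex φ X
  irredundant⇒∈-ex x∈X irredundant = ∈-ex⁺ φ x∈X (irredundant ∘ ∈φ⇒redundant)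

  IsBasis-cong : ∀ {X Y B} → φ X ≡ φ Y → IsBasis φ X B → IsBasis φ Y B
  IsBasis-cong φX≡φY (φB≡φX , minimal) =
    trans φB≡φX φX≡φY , λ B′ B′⊂B φB′≡φY → minimal B′ B′⊂B (trans φB′≡φY (sym φX≡φY))

  -- Only single-point deletions need checking: by V2, a proper subset B′ with the
  -- same closure can be enlarged to some C - x without changing the closure.
  locallyMinimal⇒isBasis : ∀ {C} → LocallyMinimal C → IsBasis φ C C
  locallyMinimal⇒isBasis {C} locMin = refl , λ where
    B′ (B′⊆C , x , x∈C , x∉B′) φB′≡φC →
      let φB′≡φC-x = φ-sandwich (p⊆q∧x∉p⇒p⊆q-x B′⊆C x∉B′) (p─q⊆p C ⁅ x ⁆) φB′≡φC
      in locMin x∈C (trans (sym φB′≡φC-x) φB′≡φC)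

  redundant? : ∀ X x → Dec (x ∈ X × Redundant X x)
  redundant? X x = (x ∈? X) ×-dec ≡-dec _≟ᵇ_ (φ (X - x)) (φ X)

  locallyMinimal-⊆ : ∀ X → Σ (Subset n) λ C → C ⊆ X × φ C ≡ φ X × LocallyMinimal C
  locallyMinimal-⊆ X = go X (<-wellFounded ∣ X ∣)
    where
    go : ∀ C → Acc _<_ ∣ C ∣ → Σ (Subset n) λ D → D ⊆ C × φ D ≡ φ C × LocallyMinimal D
    go C (acc smaller) with any? (redundant? C)
    ... | no none = C , ⊆-refl , refl , λ x∈C redundant → none (_ , x∈C , redundant)
    ... | yes (x , x∈C , redundant) with go (C - x) (smaller (x∈p⇒∣p-x∣<∣p∣ x∈C))
    ...   | D , D⊆C-x , φD≡φC-x , locMin =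
      D , ⊆-trans D⊆C-x (p─q⊆p C ⁅ x ⁆) , trans φD≡φC-x redundant , locMin

module UniquelyGeneratedViolatorSpace
  {n : ℕ} {φ : Subset n → Subset n} (V : IsViolatorSpace φ) (U : UniquelyGenerated φ) where
  open IsViolatorSpace V
  open ViolatorSpace V

  basis : Subset n → Subset n
  basis X = proj₁ (U X)

  basis-isBasis : ∀ X → IsBasis φ X (basis X)
  basis-isBasis X = proj₁ (proj₂ (U X))

  basis-unique : ∀ {X B} → IsBasis φ X B → B ≡ basis X
  basis-unique {X} {B} = proj₂ (proj₂ (U X)) B

  φ-basis : ∀ X → φ (basis X) ≡ φ X
  φ-basis X = proj₁ (basis-isBasis X)

  basis-cong : ∀ {X Y} → φ X ≡ φ Y → basis X ≡ basis Y
  basis-cong {X} φX≡φY = basis-unique (IsBasis-cong φX≡φY (basis-isBasis X))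

  basis-⊆ : ∀ X → basis X ⊆ X
  basis-⊆ X with locallyMinimal-⊆ X
  ... | C , C⊆X , φC≡φX , locMin = subst (_⊆ X) (basis-unique C-isBasis) C⊆X
    where
    C-isBasis : IsBasis φ X C
    C-isBasis = IsBasis-cong φC≡φX (locallyMinimal⇒isBasis locMin)

  ex≡basis : ∀ X → ex φ X ≡ basis X
  ex≡basis X = ⊆-antisym ex⊆basis basis⊆ex
    where
    ex⊆basis : ex φ X ⊆ basis X
    ex⊆basis {x} x∈ex with ∈-ex⇒irredundant x∈ex | x ∈? basis X
    ... | _ | yes x∈basis = x∈basis
    ... | x∈X , irredundant | no x∉basis = ⊥-elim (irredundant (trans (sym φB≡φX-x) (φ-basis X)))
      where
      φB≡φX-x : φ (basis X) ≡ φ (X - x)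
      φB≡φX-x = φ-sandwich (p⊆q∧x∉p⇒p⊆q-x (basis-⊆ X) x∉basis) (p─q⊆p X ⁅ x ⁆) (φ-basis X)
    basis⊆ex : basis X ⊆ ex φ X
    basis⊆ex {x} x∈basis = irredundant⇒∈-ex (basis-⊆ X x∈basis) λ redundant →
      x∉p-x (basis-⊆ (X - x) (subst (x ∈_) (basis-cong (sym redundant)) x∈basis))

  φ-ex : ∀ X → φ (ex φ X) ≡ φ X
  φ-ex X = trans (cong φ (ex≡basis X)) (φ-basis X)

  ex-cong : ∀ {X Y} → φ X ≡ φ Y → ex φ X ≡ ex φ Y
  ex-cong {X} {Y} φX≡φY = trans (ex≡basis X) (trans (basis-cong φX≡φY) (sym (ex≡basis Y)))

  ex≡⇒φ≡ : ∀ {X Y} → ex φ X ≡ ex φ Y → φ X ≡ φ Y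
  ex≡⇒φ≡ {X} {Y} exX≡exY = trans (sym (φ-ex X)) (trans (cong φ exX≡exY) (φ-ex Y))

  ex-idempotent : ∀ X → ex φ (ex φ X) ≡ ex φ X
  ex-idempotent X = ex-cong (φ-ex X)

  ex-∪ : ∀ {X Y} → ex φ X ≡ ex φ Y → ex φ (X ∪ Y) ≡ ex φ X
  ex-∪ exX≡exY = ex-cong (sym (φ-∪ (ex≡⇒φ≡ exX≡exY)))

  ex-sandwich : ∀ {X Y Z} → X ⊆ Y → Y ⊆ Z → ex φ X ≡ ex φ Z → ex φ X ≡ ex φ Y
  ex-sandwich X⊆Y Y⊆Z exX≡exZ = ex-cong (φ-sandwich X⊆Y Y⊆Z (ex≡⇒φ≡ exX≡exZ))

  -- (X4) is (X3) applied to ex X ⊆ X ∩ Y ⊆ X, using (X1).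
  ex-∩ : ∀ {X Y} → ex φ X ≡ ex φ Y → ex φ (X ∩ Y) ≡ ex φ X
  ex-∩ {X} {Y} exX≡exY =
    trans (sym (ex-sandwich exX⊆X∩Y (p∩q⊆p X Y) (ex-idempotent X))) (ex-idempotent X)
    where
    exX⊆X∩Y : ex φ X ⊆ X ∩ Y
    exX⊆X∩Y x∈exX = x∈p∩q⁺ (ex-⊆ φ X x∈exX , ex-⊆ φ Y (subst (_ ∈_) exX≡exY x∈exX))

proposition6 : {n : ℕ} (φ : Subset n → Subset n) →
    IsViolatorSpace φ → UniquelyGenerated φ →
    (∀ X → ex φ (ex φ X) ≡ ex φ X)
    × (∀ X Y → ex φ X ≡ ex φ Y → (ex φ (X ∪ Y) ≡ ex φ X) × (ex φ X ≡ ex φ Y))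
    × (∀ X Y Z → X ⊆ Y → Y ⊆ Z → ex φ X ≡ ex φ Z →
         (ex φ X ≡ ex φ Y) × (ex φ Y ≡ ex φ Z))
    × (∀ X Y → ex φ X ≡ ex φ Y → (ex φ (X ∩ Y) ≡ ex φ X) × (ex φ X ≡ ex φ Y))
proposition6 φ V U =
    ex-idempotent
  , (λ X Y exX≡exY → ex-∪ exX≡exY , exX≡exY)
  , (λ X Y Z X⊆Y Y⊆Z exX≡exZ →
       let exX≡exY = ex-sandwich X⊆Y Y⊆Z exX≡exZ in exX≡exY , trans (sym exX≡exY) exX≡exZ)
  , (λ X Y exX≡exY → ex-∩ exX≡exY , exX≡exY)
  where open UniquelyGeneratedViolatorSpace V U
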